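{- Let $T$ be a filling of shape $(2,2)$ with upper row entries $a=T_{2,1}$, $b=T_{2,2}$ and lower row entries $A=T_{1,1}$, $B=T_{1,2}$, and let $T'$ be the filling obtained by exchanging the entries in both rows ($T'_{2,1}=b$, $T'_{2,2}=a$, $T'_{1,1}=B$, $T'_{1,2}=A$). Suppose one of the following holds: $a\le A<b\le B$; $A<b\le B<a$; $b\le A<a\le B$; $A<a\le B<b$; $a\le B<b\le A$; $B<b\le A<a$; $b\le B<a\le A$; $B<a\le A<b$. Then \[ \#\operatorname{Des}_{2,1}(T)=\#\operatorname{Des}_{2,1}(T')\quad\text{and}\quad \operatorname{inv}_{2,1}(T)=\operatorname{inv}_{2,1}(T'). \]
   Context: Cells are $(i,j)$ with row $i$ counted from the bottom and column $j$ from the left. In shape $(2,2)$, $\operatorname{arm}((2,1))=1$ and $\operatorname{arm}((2,2))=0$. For a filling $S$ of shape $(2,2)$: $\operatorname{Inv}_2(S)=\{(1,2)\}$ if $S_{2,1}>S_{2,2}$ and $\emptyset$ otherwise; $\operatorname{Att}_{2,1}=\{((2,2),(1,1))\}$; $\operatorname{Inv}_{2,1}(S)=\{((2,k),(1,j))\in\operatorname{Att}_{2,1}: S_{2,k}>S_{1,j}\}$; $\operatorname{Des}_{2,1}(S)=\{(2,j): S_{2,j}>S_{1,j}\}$; $\operatorname{arm}_{2,1}(S)=\sum_{u\in\operatorname{Des}_{2,1}(S)}\operatorname{arm}(u)$; $\operatorname{inv}_{2,1}(S)=\#\operatorname{Inv}_2(S)+\#\operatorname{Inv}_{2,1}(S)-\operatorname{arm}_{2,1}(S)$.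 -}

module Defs where

open import Data.Nat using (ℕ; _<ᵇ_; _<?_)
open import Data.Bool using (Bool; true; false; if_then_else_)
open import Data.Integer using (ℤ; +_; _-_; _+_)
open import Data.List using (List; []; _∷_; filter; length; map)
open import Data.Nat.ListAction using (sum)
open import Data.Product using (_×_; _,_)

-- A filling of shape (2,2) with positive-integer (here: natural) entries.
-- Cells (i,j): row i from the bottom, column j from the left.
record Filling : Set where
  constructor filling
  field
    T21 T22 : ℕ
    T11 T12 : ℕ
open Filling public

Cell : Set
Cell = ℕ × ℕ

entry : Filling → Cell → ℕ
entry S (2 , 1) = T21 S
entry S (2 , 2) = T22 S
entry S (1 , 1) = T11 S
entry S (1 , 2) = T12 S
entry S _       = 0

-- arm in shape (2,2) (only needed on row-2 cells): arm((2,1))=1, arm((2,2))=0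
arm : Cell → ℕ
arm (2 , 1) = 1
arm _       = 0

swapRows : Filling → Filling
swapRows (filling a b A B) = filling b a B A

Inv₂ : Filling → List (ℕ × ℕ)
Inv₂ S = if T22 S <ᵇ T21 S then (1 , 2) ∷ [] else []

Att₂₁ : List (Cell × Cell)
Att₂₁ = ((2 , 2) , (1 , 1)) ∷ []

Inv₂₁ : Filling → List (Cell × Cell)
Inv₂₁ S = filter (λ { (u , v) → entry S v <? entry S u }) Att₂₁

Des₂₁ : Filling → List Cell
Des₂₁ S = filter (λ { (i , j) → entry S (1 , j) <? entry S (2 , j) }) ((2 , 1) ∷ (2 , 2) ∷ [])

arm₂₁ : Filling → ℕ
arm₂₁ S = sum (map arm (Des₂₁ S))

inv₂₁ : Filling → ℤ
inv₂₁ S = (+ length (Inv₂ S) + + length (Inv₂₁ S)) - + arm₂₁ S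

-- #Des₂₁ counts the columns whose upper entry exceeds the lower one, which
-- does not change when both rows are swapped. Since only the column-1
-- descent has a nonzero arm, inv₂₁ T = [b<a] + [A<b] − [A<a] and
-- inv₂₁ T′ = [a<b] + [B<a] − [B<b]; these agree exactly when
-- #{x ∈ {a,A,B} : x < b} = #{x ∈ {b,A,B} : x < a}. Each of the eight
-- orderings puts exactly one of A, B in the half-open interval between a
-- and b, so the count of A, B below max(a,b) exceeds the count below
-- min(a,b) by exactly one, which matches the single comparison min < max.
module Submission where

open import Defs
open import Data.Nat using (ℕ; suc; _+_; _≤_; _<_; _<ᵇ_)
open import Data.Nat.Properties
  using (+-comm; +-assoc; <⇒≤; ≤-trans; <-≤-trans; ≤-<-trans; <ᵇ-reflects-<; <⇒≱)
open import Data.Bool using (true; false; if_then_else_)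
open import Data.Integer as ℤ using (+_; _-_; _⊖_)
open import Data.Integer.Properties using ([+m]-[+n]≡m⊖n; +-cancelˡ-⊖)
open import Data.List using (length)
open import Data.Product using (_×_; _,_)
open import Data.Sum using (_⊎_; inj₁; inj₂)
open import Relation.Nullary using (contradiction)
open import Relation.Nullary.Reflects using (ofʸ; ofⁿ)
open import Relation.Binary.PropositionalEquality
  using (_≡_; refl; sym; trans; cong; cong₂; module ≡-Reasoning)

open ≡-Reasoning

[_<_] : ℕ → ℕ → ℕ
[ x < y ] = if x <ᵇ y then 1 else 0

[<]-yes : ∀ {x y} → x < y → [ x < y ] ≡ 1
[<]-yes {x} {y} x<y with x <ᵇ y | <ᵇ-reflects-< x y
... | true  | _        = refl
... | false | ofⁿ x≮y = contradiction x<y x≮y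

[<]-no : ∀ {x y} → y ≤ x → [ x < y ] ≡ 0
[<]-no {x} {y} y≤x with x <ᵇ y | <ᵇ-reflects-< x y
... | true  | ofʸ x<y = contradiction y≤x (<⇒≱ x<y)
... | false | _       = refl

length-Des₂₁ : ∀ S → length (Des₂₁ S) ≡ [ T11 S < T21 S ] + [ T12 S < T22 S ]
length-Des₂₁ S with T11 S <ᵇ T21 S
... | true with T12 S <ᵇ T22 S
...   | true  = refl
...   | false = refl
length-Des₂₁ S | false with T12 S <ᵇ T22 S
...   | true  = refl
...   | false = refl

arm₂₁≡[<] : ∀ S → arm₂₁ S ≡ [ T11 S < T21 S ]
arm₂₁≡[<] S with T11 S <ᵇ T21 S
... | true with T12 S <ᵇ T22 S
...   | true  = refl
...   | false = refl
arm₂₁≡[<] S | false with T12 S <ᵇ T22 S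
...   | true  = refl
...   | false = refl

length-Inv₂ : ∀ S → length (Inv₂ S) ≡ [ T22 S < T21 S ]
length-Inv₂ S with T22 S <ᵇ T21 S
... | true  = refl
... | false = refl

length-Inv₂₁ : ∀ S → length (Inv₂₁ S) ≡ [ T11 S < T22 S ]
length-Inv₂₁ S with T11 S <ᵇ T22 S
... | true  = refl
... | false = refl

inv₂₁≡[<] : ∀ S →
  inv₂₁ S ≡ + ([ T22 S < T21 S ] + [ T11 S < T22 S ]) - + [ T11 S < T21 S ]
inv₂₁≡[<] S =
  cong₂ _-_ (cong₂ (λ m n → + m ℤ.+ + n) (length-Inv₂ S) (length-Inv₂₁ S))
            (cong +_ (arm₂₁≡[<] S))

length-Des₂₁-swapRows : ∀ S → length (Des₂₁ S) ≡ length (Des₂₁ (swapRows S))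
length-Des₂₁-swapRows S = begin
  length (Des₂₁ S)                           ≡⟨ length-Des₂₁ S ⟩
  [ T11 S < T21 S ] + [ T12 S < T22 S ]      ≡⟨ +-comm [ T11 S < T21 S ] _ ⟩
  [ T12 S < T22 S ] + [ T11 S < T21 S ]      ≡⟨ sym (length-Des₂₁ (swapRows S)) ⟩
  length (Des₂₁ (swapRows S))                ∎

[+m]-[+n]≡[+o]-[+p] : ∀ m n o p → m + p ≡ o + n → + m - + n ≡ + o - + p
[+m]-[+n]≡[+o]-[+p] m n o p m+p≡o+n = begin
  + m - + n          ≡⟨ [+m]-[+n]≡m⊖n m n ⟩
  m ⊖ n              ≡⟨ sym (+-cancelˡ-⊖ p m n) ⟩
  (p + m) ⊖ (p + n)  ≡⟨ cong₂ _⊖_ p+m≡n+o (+-comm p n) ⟩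
  (n + o) ⊖ (n + p)  ≡⟨ +-cancelˡ-⊖ n o p ⟩
  o ⊖ p              ≡⟨ sym ([+m]-[+n]≡m⊖n o p) ⟩
  + o - + p          ∎
  where
  p+m≡n+o : p + m ≡ n + o
  p+m≡n+o = trans (+-comm p m) (trans m+p≡o+n (+-comm o n))

countBelow : ℕ → ℕ → ℕ → ℕ
countBelow c x y = [ x < c ] + [ y < c ]

inv₂₁-swapRows : ∀ a b A B →
  [ b < a ] + countBelow b A B ≡ [ a < b ] + countBelow a A B →
  inv₂₁ (filling a b A B) ≡ inv₂₁ (swapRows (filling a b A B))
inv₂₁-swapRows a b A B balanced = begin
  inv₂₁ (filling a b A B)                    ≡⟨ inv₂₁≡[<] (filling a b A B) ⟩
  + ([ b < a ] + [ A < b ]) - + [ A < a ]    ≡⟨ [+m]-[+n]≡[+o]-[+p] _ [ A < a ] _ [ B < b ] cross ⟩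
  + ([ a < b ] + [ B < a ]) - + [ B < b ]    ≡⟨ sym (inv₂₁≡[<] (filling b a B A)) ⟩
  inv₂₁ (swapRows (filling a b A B))         ∎
  where
  cross : [ b < a ] + [ A < b ] + [ B < b ] ≡ [ a < b ] + [ B < a ] + [ A < a ]
  cross = begin
    [ b < a ] + [ A < b ] + [ B < b ]    ≡⟨ +-assoc [ b < a ] _ _ ⟩
    [ b < a ] + countBelow b A B         ≡⟨ balanced ⟩
    [ a < b ] + countBelow a A B         ≡⟨ cong (λ n → [ a < b ] + n) (+-comm [ A < a ] _) ⟩
    [ a < b ] + ([ B < a ] + [ A < a ])  ≡⟨ sym (+-assoc [ a < b ] _ _) ⟩
    [ a < b ] + [ B < a ] + [ A < a ]    ∎

Between : ℕ → ℕ → ℕ → Set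
Between lo hi x = lo ≤ x × x < hi

Outside : ℕ → ℕ → ℕ → Set
Outside lo hi x = x < lo ⊎ hi ≤ x

ExactlyOneBetween : ℕ → ℕ → ℕ → ℕ → Set
ExactlyOneBetween lo hi x y =
  (Between lo hi x × Outside lo hi y) ⊎ (Between lo hi y × Outside lo hi x)

Between⇒< : ∀ {lo hi x} → Between lo hi x → lo < hi
Between⇒< (lo≤x , x<hi) = ≤-<-trans lo≤x x<hi

ExactlyOneBetween⇒< : ∀ {lo hi x y} → ExactlyOneBetween lo hi x y → lo < hi
ExactlyOneBetween⇒< (inj₁ (x∈ , _)) = Between⇒< x∈
ExactlyOneBetween⇒< (inj₂ (y∈ , _)) = Between⇒< y∈

[<]-Between : ∀ {lo hi x} → Between lo hi x → [ x < hi ] ≡ suc [ x < lo ]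
[<]-Between (lo≤x , x<hi) = trans ([<]-yes x<hi) (cong suc (sym ([<]-no lo≤x)))

[<]-Outside : ∀ {lo hi y} → lo ≤ hi → Outside lo hi y → [ y < hi ] ≡ [ y < lo ]
[<]-Outside lo≤hi (inj₁ y<lo) = trans ([<]-yes (<-≤-trans y<lo lo≤hi)) (sym ([<]-yes y<lo))
[<]-Outside lo≤hi (inj₂ hi≤y) = trans ([<]-no hi≤y) (sym ([<]-no (≤-trans lo≤hi hi≤y)))

countBelow-step : ∀ {lo hi x y} → Between lo hi x → Outside lo hi y →
  countBelow hi x y ≡ suc (countBelow lo x y)
countBelow-step x∈ y∉ = cong₂ _+_ ([<]-Between x∈) ([<]-Outside (<⇒≤ (Between⇒< x∈)) y∉)

countBelow-comm : ∀ c x y → countBelow c x y ≡ countBelow c y x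
countBelow-comm c x y = +-comm [ x < c ] _

ExactlyOneBetween⇒countBelow : ∀ {lo hi x y} → ExactlyOneBetween lo hi x y →
  countBelow hi x y ≡ suc (countBelow lo x y)
ExactlyOneBetween⇒countBelow (inj₁ (x∈ , y∉)) = countBelow-step x∈ y∉
ExactlyOneBetween⇒countBelow {lo} {hi} {x} {y} (inj₂ (y∈ , x∉)) = begin
  countBelow hi x y         ≡⟨ countBelow-comm hi x y ⟩
  countBelow hi y x         ≡⟨ countBelow-step y∈ x∉ ⟩
  suc (countBelow lo y x)   ≡⟨ cong suc (countBelow-comm lo y x) ⟩
  suc (countBelow lo x y)   ∎

ExactlyOneBetween⇒balanced : ∀ {a b A B} → ExactlyOneBetween a b A B →
  [ b < a ] + countBelow b A B ≡ [ a < b ] + countBelow a A B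
ExactlyOneBetween⇒balanced {a} {b} {A} {B} one = begin
  [ b < a ] + countBelow b A B   ≡⟨ cong (_+ countBelow b A B) ([<]-no (<⇒≤ a<b)) ⟩
  countBelow b A B               ≡⟨ ExactlyOneBetween⇒countBelow one ⟩
  suc (countBelow a A B)         ≡⟨ cong (_+ countBelow a A B) (sym ([<]-yes a<b)) ⟩
  [ a < b ] + countBelow a A B   ∎
  where
  a<b : a < b
  a<b = ExactlyOneBetween⇒< one

Orderings : ℕ → ℕ → ℕ → ℕ → Set
Orderings a b A B =
  (a ≤ A × A < b × b ≤ B) ⊎ (A < b × b ≤ B × B < a) ⊎
  (b ≤ A × A < a × a ≤ B) ⊎ (A < a × a ≤ B × B < b) ⊎
  (a ≤ B × B < b × b ≤ A) ⊎ (B < b × b ≤ A × A < a) ⊎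
  (b ≤ B × B < a × a ≤ A) ⊎ (B < a × a ≤ A × A < b)

Orderings⇒ExactlyOneBetween : ∀ {a b A B} → Orderings a b A B →
  ExactlyOneBetween a b A B ⊎ ExactlyOneBetween b a A B
Orderings⇒ExactlyOneBetween (inj₁ (a≤A , A<b , b≤B)) =
  inj₁ (inj₁ ((a≤A , A<b) , inj₂ b≤B))
Orderings⇒ExactlyOneBetween (inj₂ (inj₁ (A<b , b≤B , B<a))) =
  inj₂ (inj₂ ((b≤B , B<a) , inj₁ A<b))
Orderings⇒ExactlyOneBetween (inj₂ (inj₂ (inj₁ (b≤A , A<a , a≤B)))) =
  inj₂ (inj₁ ((b≤A , A<a) , inj₂ a≤B))
Orderings⇒ExactlyOneBetween (inj₂ (inj₂ (inj₂ (inj₁ (A<a , a≤B , B<b))))) =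
  inj₁ (inj₂ ((a≤B , B<b) , inj₁ A<a))
Orderings⇒ExactlyOneBetween (inj₂ (inj₂ (inj₂ (inj₂ (inj₁ (a≤B , B<b , b≤A)))))) =
  inj₁ (inj₂ ((a≤B , B<b) , inj₂ b≤A))
Orderings⇒ExactlyOneBetween (inj₂ (inj₂ (inj₂ (inj₂ (inj₂ (inj₁ (B<b , b≤A , A<a))))))) =
  inj₂ (inj₁ ((b≤A , A<a) , inj₁ B<b))
Orderings⇒ExactlyOneBetween (inj₂ (inj₂ (inj₂ (inj₂ (inj₂ (inj₂ (inj₁ (b≤B , B<a , a≤A)))))))) =
  inj₂ (inj₂ ((b≤B , B<a) , inj₂ a≤A))
Orderings⇒ExactlyOneBetween (inj₂ (inj₂ (inj₂ (inj₂ (inj₂ (inj₂ (inj₂ (B<a , a≤A , A<b)))))))) =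
  inj₁ (inj₁ ((a≤A , A<b) , inj₁ B<a))

lemma5 : (a b A B : ℕ) →
    ((a ≤ A × A < b × b ≤ B) ⊎ (A < b × b ≤ B × B < a) ⊎
     (b ≤ A × A < a × a ≤ B) ⊎ (A < a × a ≤ B × B < b) ⊎
     (a ≤ B × B < b × b ≤ A) ⊎ (B < b × b ≤ A × A < a) ⊎
     (b ≤ B × B < a × a ≤ A) ⊎ (B < a × a ≤ A × A < b)) →
    (length (Des₂₁ (filling a b A B)) ≡ length (Des₂₁ (swapRows (filling a b A B))))
    × (inv₂₁ (filling a b A B) ≡ inv₂₁ (swapRows (filling a b A B)))
lemma5 a b A B orderings =
  length-Des₂₁-swapRows (filling a b A B) , inv₂₁-swapRows a b A B balanced
  where
  balanced : [ b < a ] + countBelow b A B ≡ [ a < b ] + countBelow a A B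
  balanced with Orderings⇒ExactlyOneBetween orderings
  ... | inj₁ one = ExactlyOneBetween⇒balanced one
  ... | inj₂ one = sym (ExactlyOneBetween⇒balanced one)
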